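{- Let $n\ge 2$. (a) For all $k,l\ge0$, the number of plane trees with $n$ edges, $k$ singleton leaves and $l$ elder leaves equals the number of plane trees with $n$ edges, $l$ singleton leaves and $k$ elder leaves. (b) For all $i,j\ge 0$, the number of plane trees with $n$ edges, $i$ young leaves and $j$ young interior vertices equals the number of plane trees with $n$ edges, $j$ young leaves and $i$ young interior vertices.
   Context: A plane tree is an unlabeled rooted tree in which the children of every vertex are linearly ordered from left to right. A leaf is a vertex with no children; an interior vertex is a vertex with at least one child. A leaf without any siblings is a singleton leaf. A leaf with siblings is an elder leaf if it is the leftmost child of its parent, and a young leaf otherwise. An interior vertex is a young interior vertex if it is not the parent of a singleton leaf or of an elder leaf. -}

module Defs where

open import Data.Nat using (ℕ; zero; suc; _+_)
open import Data.List using (List; []; _∷_; length)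
open import Data.Bool using (Bool; true; false; if_then_else_)

data PTree : Set where
  node : List PTree → PTree

isLeaf : PTree → Bool
isLeaf (node [])      = true
isLeaf (node (_ ∷ _)) = false

mutual
  statT : (List PTree → ℕ) → PTree → ℕ
  statT f (node ts) = f ts + statL f ts

  statL : (List PTree → ℕ) → List PTree → ℕ
  statL f []       = 0
  statL f (t ∷ ts) = statT f t + statL f ts

-- number of edges = sum over vertices of number of children
edges : PTree → ℕ
edges = statT length

singletonLeafChildren : List PTree → ℕ
singletonLeafChildren (t ∷ []) = if isLeaf t then 1 else 0
singletonLeafChildren _        = 0

elderLeafChildren : List PTree → ℕ
elderLeafChildren (t ∷ _ ∷ _) = if isLeaf t then 1 else 0
elderLeafChildren _           = 0

leafCount : List PTree → ℕ
leafCount []       = 0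
leafCount (t ∷ ts) = (if isLeaf t then 1 else 0) + leafCount ts

youngLeafChildren : List PTree → ℕ
youngLeafChildren []       = 0
youngLeafChildren (_ ∷ ts) = leafCount ts

isYoungInterior : List PTree → ℕ
isYoungInterior []       = 0
isYoungInterior (t ∷ ts) with singletonLeafChildren (t ∷ ts) | elderLeafChildren (t ∷ ts)
... | zero | zero = 1
... | _    | _    = 0

singletonLeaves elderLeaves youngLeaves youngInteriors : PTree → ℕ
singletonLeaves = statT singletonLeafChildren
elderLeaves     = statT elderLeafChildren
youngLeaves     = statT youngLeafChildren
youngInteriors  = statT isYoungInterior

-- Plane trees with at least one edge are freely generated from the single
-- edge by three operations: planting a tree under a new root, and inserting
-- a leaf, or a tree with an edge, as a new second child of the root.  Young
-- leaves and young interior vertices are additive along this grammar,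
-- except that inserting a leaf creates a young leaf and planting creates a
-- young interior vertex; exchanging these two operations everywhere is a
-- size-preserving involution, which proves (b).  For (a), the trees with at
-- least two edges are generated by a refinement of the grammar in which the
-- single edge is split off from every argument.  Singleton and elder leaves
-- are additive along it, except at four operations that pair off: planting
-- an edge against inserting a leaf into an edge, and inserting a tree into
-- an edge against inserting an edge into a tree.  Exchanging the partners
-- of each pair swaps the two statistics.
module Submission where

open import Defs
open import Data.Nat using (ℕ; _≥_; _≤_; suc; _+_; s≤s)
open import Data.Nat.Properties using (≡-irrelevant; +-identityʳ; +-comm)
open import Data.Nat.Tactic.RingSolver using (solve-∀)
open import Data.List using (List; []; _∷_; length)
open import Data.List.NonEmpty using (List⁺; _∷_; head; tail; toList; [_])
open import Data.Maybe using (Maybe; nothing; just; maybe′; map)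
open import Data.Maybe.Properties using (map-∘; map-cong; map-id)
open import Data.Product using (Σ; _×_; _,_)
open import Data.Product.Properties using (Σ-≡,≡→≡; ×-≡,≡→≡)
open import Function using (_∘_; id)
open import Function.Bundles using (_↔_; mk↔ₛ′; Inverse)
open import Relation.Binary.PropositionalEquality
  using (_≡_; _≗_; refl; sym; trans; cong; cong₂; subst; module ≡-Reasoning)

involution-swap-↔ : {A : Set} (Φ : A → A) → Φ ∘ Φ ≗ id → (e α β : A → ℕ) →
  (∀ x → e (Φ x) ≡ e x) → (n : ℕ) → (∀ x → e x ≡ n → α (Φ x) ≡ β x) → (i j : ℕ) →
  Σ A (λ x → e x ≡ n × α x ≡ i × β x ≡ j) ↔ Σ A (λ x → e x ≡ n × α x ≡ j × β x ≡ i)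
involution-swap-↔ {A} Φ ΦΦ e α β e-Φ n α-Φ _ _ = mk↔ₛ′ swap swap swap-swap swap-swap
  where
  Holds : ℕ → ℕ → A → Set
  Holds i j x = e x ≡ n × α x ≡ i × β x ≡ j

  Holds-irrelevant : ∀ {i j x} (p q : Holds i j x) → p ≡ q
  Holds-irrelevant _ _ =
    ×-≡,≡→≡ (≡-irrelevant _ _ , ×-≡,≡→≡ (≡-irrelevant _ _ , ≡-irrelevant _ _))

  β-Φ : ∀ x → e x ≡ n → β (Φ x) ≡ α x
  β-Φ x ex = trans (sym (α-Φ (Φ x) (trans (e-Φ x) ex))) (cong α (ΦΦ x))

  swap : ∀ {i j} → Σ A (Holds i j) → Σ A (Holds j i)
  swap (x , ex , αx , βx) = Φ x , trans (e-Φ x) ex , trans (α-Φ x ex) βx , trans (β-Φ x ex) αx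

  swap-swap : ∀ {i j} (p : Σ A (Holds i j)) → swap (swap p) ≡ p
  swap-swap (x , p) = Σ-≡,≡→≡ (ΦΦ x , Holds-irrelevant _ p)

module Conjugation {A B : Set} (A↔Maybe-B : A ↔ Maybe B) (σ : B → B) where
  open Inverse A↔Maybe-B

  conjugate : A → A
  conjugate = from ∘ map σ ∘ to

  conjugate-involutive : σ ∘ σ ≗ id → conjugate ∘ conjugate ≗ id
  conjugate-involutive σσ a = begin
    from (map σ (to (from (map σ (to a)))))
      ≡⟨ cong (from ∘ map σ) (strictlyInverseˡ (map σ (to a))) ⟩
    from (map σ (map σ (to a)))
      ≡⟨ cong from (sym (map-∘ (to a))) ⟩
    from (map (σ ∘ σ) (to a))
      ≡⟨ cong from (trans (map-cong σσ (to a)) (map-id (to a))) ⟩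
    from (to a)
      ≡⟨ strictlyInverseʳ a ⟩
    a ∎
    where open ≡-Reasoning

  conjugate-preserves : (R : A → A → Set) → R (from nothing) (from nothing) →
    (∀ b → R (from (just (σ b))) (from (just b))) → ∀ a → R (conjugate a) a
  conjugate-preserves R r-nothing r-just a =
    subst (R (conjugate a)) (strictlyInverseʳ a) (on-to (to a))
    where
    on-to : ∀ m → R (from (map σ m)) (from m)
    on-to nothing  = r-nothing
    on-to (just b) = r-just b

leaf : PTree
leaf = node []

statT-plant : ∀ g x → statT g (node (x ∷ [])) ≡ g (x ∷ []) + statT g x
statT-plant g x = cong (g (x ∷ []) +_) (+-identityʳ (statT g x))

insertSecond : ∀ {A : Set} → A → List⁺ A → List⁺ A
insertSecond y (x ∷ xs) = x ∷ y ∷ xs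

statT-insertSecond : ∀ g y cs δ → g (toList (insertSecond y cs)) ≡ δ + g (toList cs) →
  statT g (node (toList (insertSecond y cs))) ≡ δ + statT g (node (toList cs)) + statT g y
statT-insertSecond g y (x ∷ xs) δ root = begin
  g (x ∷ y ∷ xs) + (statT g x + (statT g y + statL g xs))
    ≡⟨ cong (_+ (statT g x + (statT g y + statL g xs))) root ⟩
  δ + g (x ∷ xs) + (statT g x + (statT g y + statL g xs))
    ≡⟨ regroup δ (g (x ∷ xs)) (statT g x) (statT g y) (statL g xs) ⟩
  δ + (g (x ∷ xs) + (statT g x + statL g xs)) + statT g y ∎
  where
  open ≡-Reasoning
  regroup : ∀ d r a b l → d + r + (a + (b + l)) ≡ d + (r + (a + l)) + b
  regroup = solve-∀

isYoungInterior-insertSecond : ∀ y cs →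
  isYoungInterior (toList (insertSecond y cs)) ≡ isYoungInterior (toList cs)
isYoungInterior-insertSecond y (node []      ∷ [])    = refl
isYoungInterior-insertSecond y (node []      ∷ _ ∷ _) = refl
isYoungInterior-insertSecond y (node (_ ∷ _) ∷ [])    = refl
isYoungInterior-insertSecond y (node (_ ∷ _) ∷ _ ∷ _) = refl

elderLeafChildren-insertSecond : ∀ y cs → singletonLeafChildren (toList cs) ≡ 0 →
  elderLeafChildren (toList (insertSecond y cs)) ≡ elderLeafChildren (toList cs)
elderLeafChildren-insertSecond y (_             ∷ _ ∷ _) _  = refl
elderLeafChildren-insertSecond y (node []      ∷ [])    ()
elderLeafChildren-insertSecond y (node (_ ∷ _) ∷ [])    _  = refl

data Tree⁺ : Set where
  edge            : Tree⁺
  plant graftLeaf : Tree⁺ → Tree⁺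
  graft           : Tree⁺ → Tree⁺ → Tree⁺

mutual
  ⟦_⟧ : Tree⁺ → PTree
  ⟦ c ⟧ = node (toList (children c))

  children : Tree⁺ → List⁺ PTree
  children edge          = [ leaf ]
  children (plant c)     = [ ⟦ c ⟧ ]
  children (graftLeaf c) = insertSecond leaf (children c)
  children (graft c u)   = insertSecond ⟦ u ⟧ (children c)

-- The list is split first, so that code x (y ∷ xs) reduces for a variable x.
code : PTree → List PTree → Tree⁺
code x (node [] ∷ xs)       = graftLeaf (code x xs)
code x (node (y ∷ ys) ∷ xs) = graft (code x xs) (code y ys)
code (node [])       []     = edge
code (node (x ∷ xs)) []     = plant (code x xs)

children-code : ∀ x xs → children (code x xs) ≡ x ∷ xs
children-code x (node [] ∷ xs)       = cong (insertSecond leaf) (children-code x xs)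
children-code x (node (y ∷ ys) ∷ xs) =
  cong₂ (λ cs ds → insertSecond (node (toList ds)) cs) (children-code x xs) (children-code y ys)
children-code (node [])       []     = refl
children-code (node (x ∷ xs)) []     = cong (λ cs → [ node (toList cs) ]) (children-code x xs)

code-children : ∀ c → code (head (children c)) (tail (children c)) ≡ c
code-children edge          = refl
code-children (plant c)     = cong plant (code-children c)
code-children (graftLeaf c) = cong graftLeaf (code-children c)
code-children (graft c u)   = cong₂ graft (code-children c) (code-children u)

PTree↔Maybe-Tree⁺ : PTree ↔ Maybe Tree⁺
PTree↔Maybe-Tree⁺ = mk↔ₛ′ encode (maybe′ ⟦_⟧ leaf) encode-decode decode-encode
  where
  encode : PTree → Maybe Tree⁺
  encode (node [])       = nothing
  encode (node (x ∷ xs)) = just (code x xs)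

  encode-decode : ∀ m → encode (maybe′ ⟦_⟧ leaf m) ≡ m
  encode-decode nothing  = refl
  encode-decode (just c) = cong just (code-children c)

  decode-encode : ∀ t → maybe′ ⟦_⟧ leaf (encode t) ≡ t
  decode-encode (node [])       = refl
  decode-encode (node (x ∷ xs)) = cong (node ∘ toList) (children-code x xs)

size : Tree⁺ → ℕ
size edge          = 1
size (plant c)     = suc (size c)
size (graftLeaf c) = suc (size c)
size (graft c u)   = suc (size c + size u)

edges-⟦⟧ : ∀ c → edges ⟦ c ⟧ ≡ size c
edges-⟦⟧ edge          = refl
edges-⟦⟧ (plant c)     = trans (statT-plant length ⟦ c ⟧) (cong suc (edges-⟦⟧ c))
edges-⟦⟧ (graftLeaf c) =
  trans (statT-insertSecond length leaf (children c) 1 refl)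
        (trans (+-identityʳ _) (cong suc (edges-⟦⟧ c)))
edges-⟦⟧ (graft c u)   =
  trans (statT-insertSecond length ⟦ u ⟧ (children c) 1 refl)
        (cong₂ (λ a b → suc (a + b)) (edges-⟦⟧ c) (edges-⟦⟧ u))

-- Young leaves and young interior vertices

youngLeaves⁺ youngInteriors⁺ : Tree⁺ → ℕ
youngLeaves⁺ edge          = 0
youngLeaves⁺ (plant c)     = youngLeaves⁺ c
youngLeaves⁺ (graftLeaf c) = suc (youngLeaves⁺ c)
youngLeaves⁺ (graft c u)   = youngLeaves⁺ c + youngLeaves⁺ u
youngInteriors⁺ edge          = 0
youngInteriors⁺ (plant c)     = suc (youngInteriors⁺ c)
youngInteriors⁺ (graftLeaf c) = youngInteriors⁺ c
youngInteriors⁺ (graft c u)   = youngInteriors⁺ c + youngInteriors⁺ u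

youngLeaves-⟦⟧ : ∀ c → youngLeaves ⟦ c ⟧ ≡ youngLeaves⁺ c
youngLeaves-⟦⟧ edge          = refl
youngLeaves-⟦⟧ (plant c)     = trans (statT-plant youngLeafChildren ⟦ c ⟧) (youngLeaves-⟦⟧ c)
youngLeaves-⟦⟧ (graftLeaf c) =
  trans (statT-insertSecond youngLeafChildren leaf (children c) 1 refl)
        (trans (+-identityʳ _) (cong suc (youngLeaves-⟦⟧ c)))
youngLeaves-⟦⟧ (graft c u)   =
  trans (statT-insertSecond youngLeafChildren ⟦ u ⟧ (children c) 0 refl)
        (cong₂ _+_ (youngLeaves-⟦⟧ c) (youngLeaves-⟦⟧ u))

youngInteriors-⟦⟧ : ∀ c → youngInteriors ⟦ c ⟧ ≡ youngInteriors⁺ c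
youngInteriors-⟦⟧ edge          = refl
youngInteriors-⟦⟧ (plant c)     =
  trans (statT-plant isYoungInterior ⟦ c ⟧) (cong suc (youngInteriors-⟦⟧ c))
youngInteriors-⟦⟧ (graftLeaf c) =
  trans (statT-insertSecond isYoungInterior leaf (children c) 0
          (isYoungInterior-insertSecond leaf (children c)))
        (trans (+-identityʳ _) (youngInteriors-⟦⟧ c))
youngInteriors-⟦⟧ (graft c u)   =
  trans (statT-insertSecond isYoungInterior ⟦ u ⟧ (children c) 0
          (isYoungInterior-insertSecond ⟦ u ⟧ (children c)))
        (cong₂ _+_ (youngInteriors-⟦⟧ c) (youngInteriors-⟦⟧ u))

swapYoung⁺ : Tree⁺ → Tree⁺
swapYoung⁺ edge          = edge
swapYoung⁺ (plant c)     = graftLeaf (swapYoung⁺ c)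
swapYoung⁺ (graftLeaf c) = plant (swapYoung⁺ c)
swapYoung⁺ (graft c u)   = graft (swapYoung⁺ c) (swapYoung⁺ u)

swapYoung⁺-involutive : swapYoung⁺ ∘ swapYoung⁺ ≗ id
swapYoung⁺-involutive edge          = refl
swapYoung⁺-involutive (plant c)     = cong plant (swapYoung⁺-involutive c)
swapYoung⁺-involutive (graftLeaf c) = cong graftLeaf (swapYoung⁺-involutive c)
swapYoung⁺-involutive (graft c u)   =
  cong₂ graft (swapYoung⁺-involutive c) (swapYoung⁺-involutive u)

size-swapYoung⁺ : ∀ c → size (swapYoung⁺ c) ≡ size c
size-swapYoung⁺ edge          = refl
size-swapYoung⁺ (plant c)     = cong suc (size-swapYoung⁺ c)
size-swapYoung⁺ (graftLeaf c) = cong suc (size-swapYoung⁺ c)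
size-swapYoung⁺ (graft c u)   = cong₂ (λ a b → suc (a + b)) (size-swapYoung⁺ c) (size-swapYoung⁺ u)

youngLeaves⁺-swapYoung⁺ : ∀ c → youngLeaves⁺ (swapYoung⁺ c) ≡ youngInteriors⁺ c
youngLeaves⁺-swapYoung⁺ edge          = refl
youngLeaves⁺-swapYoung⁺ (plant c)     = cong suc (youngLeaves⁺-swapYoung⁺ c)
youngLeaves⁺-swapYoung⁺ (graftLeaf c) = youngLeaves⁺-swapYoung⁺ c
youngLeaves⁺-swapYoung⁺ (graft c u)   =
  cong₂ _+_ (youngLeaves⁺-swapYoung⁺ c) (youngLeaves⁺-swapYoung⁺ u)

open Conjugation PTree↔Maybe-Tree⁺ swapYoung⁺ using ()
  renaming (conjugate to swapYoung; conjugate-preserves to swapYoung-preserves)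

swapYoung-involutive : swapYoung ∘ swapYoung ≗ id
swapYoung-involutive =
  Conjugation.conjugate-involutive PTree↔Maybe-Tree⁺ swapYoung⁺ swapYoung⁺-involutive

edges-swapYoung : ∀ t → edges (swapYoung t) ≡ edges t
edges-swapYoung = swapYoung-preserves (λ t′ t → edges t′ ≡ edges t) refl λ c →
  trans (edges-⟦⟧ (swapYoung⁺ c)) (trans (size-swapYoung⁺ c) (sym (edges-⟦⟧ c)))

youngLeaves-swapYoung : ∀ t → youngLeaves (swapYoung t) ≡ youngInteriors t
youngLeaves-swapYoung = swapYoung-preserves (λ t′ t → youngLeaves t′ ≡ youngInteriors t) refl λ c →
  trans (youngLeaves-⟦⟧ (swapYoung⁺ c))
        (trans (youngLeaves⁺-swapYoung⁺ c) (sym (youngInteriors-⟦⟧ c)))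

-- Singleton and elder leaves

data Tree⁺⁺ : Set where
  plantEdge graftLeafOnEdge graftEdgeOnEdge   : Tree⁺⁺
  plant graftOnEdge graftLeaf graftEdge       : Tree⁺⁺ → Tree⁺⁺
  graft                                       : Tree⁺⁺ → Tree⁺⁺ → Tree⁺⁺

embed : Tree⁺⁺ → Tree⁺
embed plantEdge       = plant edge
embed graftLeafOnEdge = graftLeaf edge
embed graftEdgeOnEdge = graft edge edge
embed (plant d)       = plant (embed d)
embed (graftOnEdge d) = graft edge (embed d)
embed (graftLeaf d)   = graftLeaf (embed d)
embed (graftEdge d)   = graft (embed d) edge
embed (graft d d′)    = graft (embed d) (embed d′)

extend : Maybe Tree⁺⁺ → Tree⁺
extend = maybe′ embed edge

plant′ graftLeaf′ : Maybe Tree⁺⁺ → Tree⁺⁺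
plant′ nothing      = plantEdge
plant′ (just d)     = plant d
graftLeaf′ nothing  = graftLeafOnEdge
graftLeaf′ (just d) = graftLeaf d

graft′ : Maybe Tree⁺⁺ → Maybe Tree⁺⁺ → Tree⁺⁺
graft′ nothing  nothing   = graftEdgeOnEdge
graft′ nothing  (just d′) = graftOnEdge d′
graft′ (just d) nothing   = graftEdge d
graft′ (just d) (just d′) = graft d d′

embed-plant′ : ∀ m → embed (plant′ m) ≡ plant (extend m)
embed-plant′ nothing  = refl
embed-plant′ (just _) = refl

embed-graftLeaf′ : ∀ m → embed (graftLeaf′ m) ≡ graftLeaf (extend m)
embed-graftLeaf′ nothing  = refl
embed-graftLeaf′ (just _) = refl

embed-graft′ : ∀ m m′ → embed (graft′ m m′) ≡ graft (extend m) (extend m′)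
embed-graft′ nothing  nothing  = refl
embed-graft′ nothing  (just _) = refl
embed-graft′ (just _) nothing  = refl
embed-graft′ (just _) (just _) = refl

restrict : Tree⁺ → Maybe Tree⁺⁺
restrict edge          = nothing
restrict (plant c)     = just (plant′ (restrict c))
restrict (graftLeaf c) = just (graftLeaf′ (restrict c))
restrict (graft c u)   = just (graft′ (restrict c) (restrict u))

extend-restrict : ∀ c → extend (restrict c) ≡ c
extend-restrict edge          = refl
extend-restrict (plant c)     = trans (embed-plant′ (restrict c)) (cong plant (extend-restrict c))
extend-restrict (graftLeaf c) =
  trans (embed-graftLeaf′ (restrict c)) (cong graftLeaf (extend-restrict c))
extend-restrict (graft c u)   =
  trans (embed-graft′ (restrict c) (restrict u))
        (cong₂ graft (extend-restrict c) (extend-restrict u))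

restrict-embed : ∀ d → restrict (embed d) ≡ just d
restrict-embed plantEdge       = refl
restrict-embed graftLeafOnEdge = refl
restrict-embed graftEdgeOnEdge = refl
restrict-embed (plant d)       = cong (just ∘ plant′) (restrict-embed d)
restrict-embed (graftOnEdge d) = cong (just ∘ graft′ nothing) (restrict-embed d)
restrict-embed (graftLeaf d)   = cong (just ∘ graftLeaf′) (restrict-embed d)
restrict-embed (graftEdge d)   = cong (λ m → just (graft′ m nothing)) (restrict-embed d)
restrict-embed (graft d d′)    =
  cong₂ (λ m m′ → just (graft′ m m′)) (restrict-embed d) (restrict-embed d′)

Tree⁺↔Maybe-Tree⁺⁺ : Tree⁺ ↔ Maybe Tree⁺⁺
Tree⁺↔Maybe-Tree⁺⁺ = mk↔ₛ′ restrict extend restrict-extend extend-restrict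
  where
  restrict-extend : ∀ m → restrict (extend m) ≡ m
  restrict-extend nothing  = refl
  restrict-extend (just d) = restrict-embed d

singletonLeaves⁺⁺ elderLeaves⁺⁺ : Tree⁺⁺ → ℕ
singletonLeaves⁺⁺ plantEdge       = 1
singletonLeaves⁺⁺ graftLeafOnEdge = 0
singletonLeaves⁺⁺ graftEdgeOnEdge = 1
singletonLeaves⁺⁺ (plant d)       = singletonLeaves⁺⁺ d
singletonLeaves⁺⁺ (graftOnEdge d) = singletonLeaves⁺⁺ d
singletonLeaves⁺⁺ (graftLeaf d)   = singletonLeaves⁺⁺ d
singletonLeaves⁺⁺ (graftEdge d)   = suc (singletonLeaves⁺⁺ d)
singletonLeaves⁺⁺ (graft d d′)    = singletonLeaves⁺⁺ d + singletonLeaves⁺⁺ d′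
elderLeaves⁺⁺ plantEdge       = 0
elderLeaves⁺⁺ graftLeafOnEdge = 1
elderLeaves⁺⁺ graftEdgeOnEdge = 1
elderLeaves⁺⁺ (plant d)       = elderLeaves⁺⁺ d
elderLeaves⁺⁺ (graftOnEdge d) = suc (elderLeaves⁺⁺ d)
elderLeaves⁺⁺ (graftLeaf d)   = elderLeaves⁺⁺ d
elderLeaves⁺⁺ (graftEdge d)   = elderLeaves⁺⁺ d
elderLeaves⁺⁺ (graft d d′)    = elderLeaves⁺⁺ d + elderLeaves⁺⁺ d′

singletonLeafChildren-embed : ∀ d → singletonLeafChildren (toList (children (embed d))) ≡ 0
singletonLeafChildren-embed plantEdge       = refl
singletonLeafChildren-embed graftLeafOnEdge = refl
singletonLeafChildren-embed graftEdgeOnEdge = refl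
singletonLeafChildren-embed (plant _)       = refl
singletonLeafChildren-embed (graftOnEdge _) = refl
singletonLeafChildren-embed (graftLeaf _)   = refl
singletonLeafChildren-embed (graftEdge _)   = refl
singletonLeafChildren-embed (graft _ _)     = refl

singletonLeaves-embed : ∀ d → singletonLeaves ⟦ embed d ⟧ ≡ singletonLeaves⁺⁺ d
singletonLeaves-embed plantEdge       = refl
singletonLeaves-embed graftLeafOnEdge = refl
singletonLeaves-embed graftEdgeOnEdge = refl
singletonLeaves-embed (plant d)       =
  trans (statT-plant singletonLeafChildren ⟦ embed d ⟧) (singletonLeaves-embed d)
singletonLeaves-embed (graftOnEdge d) = trans (+-identityʳ _) (singletonLeaves-embed d)
singletonLeaves-embed (graftLeaf d)   =
  trans (statT-insertSecond singletonLeafChildren leaf (children (embed d)) 0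
          (sym (singletonLeafChildren-embed d)))
        (trans (+-identityʳ _) (singletonLeaves-embed d))
singletonLeaves-embed (graftEdge d)   =
  trans (statT-insertSecond singletonLeafChildren ⟦ edge ⟧ (children (embed d)) 0
          (sym (singletonLeafChildren-embed d)))
        (trans (+-comm _ 1) (cong suc (singletonLeaves-embed d)))
singletonLeaves-embed (graft d d′)    =
  trans (statT-insertSecond singletonLeafChildren ⟦ embed d′ ⟧ (children (embed d)) 0
          (sym (singletonLeafChildren-embed d)))
        (cong₂ _+_ (singletonLeaves-embed d) (singletonLeaves-embed d′))

elderLeaves-embed : ∀ d → elderLeaves ⟦ embed d ⟧ ≡ elderLeaves⁺⁺ d
elderLeaves-embed plantEdge       = refl
elderLeaves-embed graftLeafOnEdge = refl
elderLeaves-embed graftEdgeOnEdge = refl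
elderLeaves-embed (plant d)       =
  trans (statT-plant elderLeafChildren ⟦ embed d ⟧) (elderLeaves-embed d)
elderLeaves-embed (graftOnEdge d) = cong suc (trans (+-identityʳ _) (elderLeaves-embed d))
elderLeaves-embed (graftLeaf d)   =
  trans (statT-insertSecond elderLeafChildren leaf (children (embed d)) 0
          (elderLeafChildren-insertSecond leaf (children (embed d))
            (singletonLeafChildren-embed d)))
        (trans (+-identityʳ _) (elderLeaves-embed d))
elderLeaves-embed (graftEdge d)   =
  trans (statT-insertSecond elderLeafChildren ⟦ edge ⟧ (children (embed d)) 0
          (elderLeafChildren-insertSecond ⟦ edge ⟧ (children (embed d))
            (singletonLeafChildren-embed d)))
        (trans (+-identityʳ _) (elderLeaves-embed d))
elderLeaves-embed (graft d d′)    =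
  trans (statT-insertSecond elderLeafChildren ⟦ embed d′ ⟧ (children (embed d)) 0
          (elderLeafChildren-insertSecond ⟦ embed d′ ⟧ (children (embed d))
            (singletonLeafChildren-embed d)))
        (cong₂ _+_ (elderLeaves-embed d) (elderLeaves-embed d′))

swapLeaves⁺⁺ : Tree⁺⁺ → Tree⁺⁺
swapLeaves⁺⁺ plantEdge       = graftLeafOnEdge
swapLeaves⁺⁺ graftLeafOnEdge = plantEdge
swapLeaves⁺⁺ graftEdgeOnEdge = graftEdgeOnEdge
swapLeaves⁺⁺ (plant d)       = plant (swapLeaves⁺⁺ d)
swapLeaves⁺⁺ (graftOnEdge d) = graftEdge (swapLeaves⁺⁺ d)
swapLeaves⁺⁺ (graftLeaf d)   = graftLeaf (swapLeaves⁺⁺ d)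
swapLeaves⁺⁺ (graftEdge d)   = graftOnEdge (swapLeaves⁺⁺ d)
swapLeaves⁺⁺ (graft d d′)    = graft (swapLeaves⁺⁺ d) (swapLeaves⁺⁺ d′)

swapLeaves⁺⁺-involutive : swapLeaves⁺⁺ ∘ swapLeaves⁺⁺ ≗ id
swapLeaves⁺⁺-involutive plantEdge       = refl
swapLeaves⁺⁺-involutive graftLeafOnEdge = refl
swapLeaves⁺⁺-involutive graftEdgeOnEdge = refl
swapLeaves⁺⁺-involutive (plant d)       = cong plant (swapLeaves⁺⁺-involutive d)
swapLeaves⁺⁺-involutive (graftOnEdge d) = cong graftOnEdge (swapLeaves⁺⁺-involutive d)
swapLeaves⁺⁺-involutive (graftLeaf d)   = cong graftLeaf (swapLeaves⁺⁺-involutive d)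
swapLeaves⁺⁺-involutive (graftEdge d)   = cong graftEdge (swapLeaves⁺⁺-involutive d)
swapLeaves⁺⁺-involutive (graft d d′)    =
  cong₂ graft (swapLeaves⁺⁺-involutive d) (swapLeaves⁺⁺-involutive d′)

size-swapLeaves⁺⁺ : ∀ d → size (embed (swapLeaves⁺⁺ d)) ≡ size (embed d)
size-swapLeaves⁺⁺ plantEdge       = refl
size-swapLeaves⁺⁺ graftLeafOnEdge = refl
size-swapLeaves⁺⁺ graftEdgeOnEdge = refl
size-swapLeaves⁺⁺ (plant d)       = cong suc (size-swapLeaves⁺⁺ d)
size-swapLeaves⁺⁺ (graftOnEdge d) =
  cong suc (trans (+-comm _ 1) (cong suc (size-swapLeaves⁺⁺ d)))
size-swapLeaves⁺⁺ (graftLeaf d)   = cong suc (size-swapLeaves⁺⁺ d)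
size-swapLeaves⁺⁺ (graftEdge d)   =
  cong suc (trans (cong suc (size-swapLeaves⁺⁺ d)) (+-comm 1 _))
size-swapLeaves⁺⁺ (graft d d′)    =
  cong₂ (λ a b → suc (a + b)) (size-swapLeaves⁺⁺ d) (size-swapLeaves⁺⁺ d′)

singletonLeaves⁺⁺-swapLeaves⁺⁺ : ∀ d →
  singletonLeaves⁺⁺ (swapLeaves⁺⁺ d) ≡ elderLeaves⁺⁺ d
singletonLeaves⁺⁺-swapLeaves⁺⁺ plantEdge       = refl
singletonLeaves⁺⁺-swapLeaves⁺⁺ graftLeafOnEdge = refl
singletonLeaves⁺⁺-swapLeaves⁺⁺ graftEdgeOnEdge = refl
singletonLeaves⁺⁺-swapLeaves⁺⁺ (plant d)       = singletonLeaves⁺⁺-swapLeaves⁺⁺ d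
singletonLeaves⁺⁺-swapLeaves⁺⁺ (graftOnEdge d) =
  cong suc (singletonLeaves⁺⁺-swapLeaves⁺⁺ d)
singletonLeaves⁺⁺-swapLeaves⁺⁺ (graftLeaf d)   = singletonLeaves⁺⁺-swapLeaves⁺⁺ d
singletonLeaves⁺⁺-swapLeaves⁺⁺ (graftEdge d)   = singletonLeaves⁺⁺-swapLeaves⁺⁺ d
singletonLeaves⁺⁺-swapLeaves⁺⁺ (graft d d′)    =
  cong₂ _+_ (singletonLeaves⁺⁺-swapLeaves⁺⁺ d) (singletonLeaves⁺⁺-swapLeaves⁺⁺ d′)

open Conjugation Tree⁺↔Maybe-Tree⁺⁺ swapLeaves⁺⁺ using ()
  renaming (conjugate to swapLeaves⁺; conjugate-preserves to swapLeaves⁺-preserves)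

size-swapLeaves⁺ : ∀ c → size (swapLeaves⁺ c) ≡ size c
size-swapLeaves⁺ =
  swapLeaves⁺-preserves (λ c′ c → size c′ ≡ size c) refl size-swapLeaves⁺⁺

singletonLeaves-swapLeaves⁺ : ∀ c → 2 ≤ size c →
  singletonLeaves ⟦ swapLeaves⁺ c ⟧ ≡ elderLeaves ⟦ c ⟧
singletonLeaves-swapLeaves⁺ = swapLeaves⁺-preserves
  (λ c′ c → 2 ≤ size c → singletonLeaves ⟦ c′ ⟧ ≡ elderLeaves ⟦ c ⟧)
  (λ { (s≤s ()) })
  λ d _ → trans (singletonLeaves-embed (swapLeaves⁺⁺ d))
                (trans (singletonLeaves⁺⁺-swapLeaves⁺⁺ d) (sym (elderLeaves-embed d)))

open Conjugation PTree↔Maybe-Tree⁺ swapLeaves⁺ using ()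
  renaming (conjugate to swapLeaves; conjugate-preserves to swapLeaves-preserves)

swapLeaves-involutive : swapLeaves ∘ swapLeaves ≗ id
swapLeaves-involutive =
  Conjugation.conjugate-involutive PTree↔Maybe-Tree⁺ swapLeaves⁺
    (Conjugation.conjugate-involutive Tree⁺↔Maybe-Tree⁺⁺ swapLeaves⁺⁺
      swapLeaves⁺⁺-involutive)

edges-swapLeaves : ∀ t → edges (swapLeaves t) ≡ edges t
edges-swapLeaves = swapLeaves-preserves (λ t′ t → edges t′ ≡ edges t) refl λ c →
  trans (edges-⟦⟧ (swapLeaves⁺ c)) (trans (size-swapLeaves⁺ c) (sym (edges-⟦⟧ c)))

singletonLeaves-swapLeaves : ∀ t → 2 ≤ edges t →
  singletonLeaves (swapLeaves t) ≡ elderLeaves t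
singletonLeaves-swapLeaves = swapLeaves-preserves
  (λ t′ t → 2 ≤ edges t → singletonLeaves t′ ≡ elderLeaves t)
  (λ ())
  λ c 2≤edges → singletonLeaves-swapLeaves⁺ c (subst (2 ≤_) (edges-⟦⟧ c) 2≤edges)

corollary1p10 : (n : ℕ) → n ≥ 2 →
    ((k l : ℕ) →
      (Σ PTree (λ t → edges t ≡ n × singletonLeaves t ≡ k × elderLeaves t ≡ l))
      ↔ (Σ PTree (λ t → edges t ≡ n × singletonLeaves t ≡ l × elderLeaves t ≡ k)))
    × ((i j : ℕ) →
      (Σ PTree (λ t → edges t ≡ n × youngLeaves t ≡ i × youngInteriors t ≡ j))
      ↔ (Σ PTree (λ t → edges t ≡ n × youngLeaves t ≡ j × youngInteriors t ≡ i)))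
corollary1p10 n n≥2 =
    involution-swap-↔ swapLeaves swapLeaves-involutive
      edges singletonLeaves elderLeaves edges-swapLeaves n
      (λ t edges≡n → singletonLeaves-swapLeaves t (subst (2 ≤_) (sym edges≡n) n≥2))
  , involution-swap-↔ swapYoung swapYoung-involutive
      edges youngLeaves youngInteriors edges-swapYoung n
      (λ t _ → youngLeaves-swapYoung t)
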